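{- Let $n\ge 1$ and let $c_1,\ldots,c_n$ be positive integers. Let $x=[0,\overline{c_1,\ldots,c_n}]$ be the quadratic irrational with periodic simple continued fraction expansion with initial digit $0$ and repeating block $c_1,\ldots,c_n$, and let $x_q$ be its rational part. Then the following are equivalent: (a) $2x_q\in\mathbb{Z}$; (b) $2x_q=-c_n$; (c) the sequence $c_1,\ldots,c_{n-1}$ is symmetric, i.e. $c_k=c_{n-k}$ for $k=1,\ldots,n-1$ (this condition is vacuous when $n=1$).
   Context: A simple continued fraction $[c_0,c_1,c_2,\ldots]$ has $c_0\in\mathbb{Z}$ and $c_k$ positive integers for $k\ge1$; $[0,\overline{c_1,\ldots,c_n}]$ denotes $[0,c_1,\ldots,c_n,c_1,\ldots,c_n,\ldots]$. Every quadratic irrational $x$ can be written uniquely as $x=a+\sqrt b$ with $a,b$ rational, $b>0$ not a square, where $\sqrt b$ denotes a (positive or negative) real square root of $b$; $a$ is called the rational part of $x$, written $x_q$. -}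

module Defs where

open import Data.Nat using (ℕ; suc)
open import Data.Integer using (ℤ; +_)
open import Data.Rational using (ℚ; _+_; _*_; _/_; 0ℚ; 1ℚ)
open import Data.Fin using (Fin; zero; suc; inject₁; fromℕ; opposite)
open import Data.Product using (_×_; _,_; proj₁; Σ; ∃)
open import Relation.Binary.PropositionalEquality using (_≡_)
open import Relation.Nullary using (¬_)

ℤ→ℚ : ℤ → ℚ
ℤ→ℚ z = z / 1

ℕ→ℚ : ℕ → ℚ
ℕ→ℚ n = (+ n) / 1

IsSquareℚ : ℚ → Set
IsSquareℚ b = ∃ λ (r : ℚ) → r * r ≡ b

-- Elements u + v·√b of the quadratic field ℚ(√b), for a fixed rational b
-- (a formal square root of b), represented as pairs (u , v).
Qsqrt : Set
Qsqrt = ℚ × ℚ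

ratPart : Qsqrt → ℚ
ratPart = proj₁

module _ (b : ℚ) where
  infixl 6 _⊕_
  infixl 7 _⊗_
  _⊕_ : Qsqrt → Qsqrt → Qsqrt
  (u₁ , v₁) ⊕ (u₂ , v₂) = (u₁ + u₂ , v₁ + v₂)

  _⊗_ : Qsqrt → Qsqrt → Qsqrt
  (u₁ , v₁) ⊗ (u₂ , v₂) = (u₁ * u₂ + b * (v₁ * v₂) , u₁ * v₂ + v₁ * u₂)

embℕ : ℕ → Qsqrt
embℕ n = (ℕ→ℚ n , 0ℚ)

oneQ : Qsqrt
oneQ = (1ℚ , 0ℚ)

-- PeriodicCF m c b t : inside ℚ(√b) (b non-square), the tuple
-- t 0 , t 1 , … , t n  (n = suc m) are the complete quotient tails of the
-- continued fraction  x = [0, c₁, …, cₙ, c₁, …]  with x = t 0, i.e.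
--   t (k-1) = 1 / (c_k + t k)   for k = 1 … n,   and   t n = t 0.
-- Here c : Fin n → ℕ with c i = c_{i+1}.
PeriodicCF : (m : ℕ) → (Fin (suc m) → ℕ) → ℚ → (Fin (suc (suc m)) → Qsqrt) → Set
PeriodicCF m c b t =
  (¬ IsSquareℚ b)
  × ((i : Fin (suc m)) → _⊗_ b (t (inject₁ i)) (_⊕_ b (embℕ (c i)) (t (suc i))) ≡ oneQ)
  × (t (fromℕ (suc m)) ≡ t zero)

{-# OPTIONS --safe #-}
-- Multiplying out tₖ₋₁ = 1 / (cₖ + tₖ) over one period gives the Möbius relation t₀ = (A t₀ + B) / (C t₀ + D),
-- where [[A, B], [C, D]] = P c₁ ⋯ P cₙ and P x = [[0, 1], [1, x]].  This matrix has determinant ±1 and a trace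
-- large enough that the discriminant Δ = (D - A)² + 4BC is not a square, so t₀ is irrational and the √b-part
-- of the relation forces 2C x_q = A - D.  Writing the product as [[p, q], [r, s]] · P cₙ, this says
-- s (2x_q + cₙ) = q - r with |q - r| < s; hence 2x_q is an integer iff 2x_q = -cₙ iff q = r.  Transposition
-- reverses the product and positive digits are determined by it, so q = r iff c₁ … cₙ₋₁ is a palindrome.
-- Conversely, running the recursion backwards from the root (A - D + √Δ) / 2C of the relation in ℚ(√Δ)
-- yields a purely periodic expansion.
module Submission where

open import Defs
open import Data.Nat using (ℕ; zero; suc; _≤_; _<_; z≤n; s≤s)
import Data.Nat as ℕ
import Data.Nat.Properties as ℕ
import Data.Nat.Coprimality as Coprimality
open import Data.Nat.Divisibility using (_∣_; divides; ∣-refl)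
import Data.Integer as ℤ
import Data.Integer.Properties as ℤ
import Data.Integer.GCD as ℤ using (gcd)
import Data.Rational as ℚ
import Data.Rational.Properties as ℚ
open import Data.Fin using (Fin; zero; suc; inject₁; fromℕ; opposite)
open import Data.Product using (_×_; _,_; proj₁; proj₂; Σ; ∃)
open import Data.Sum using (_⊎_; inj₁; inj₂)
open import Data.Empty using (⊥; ⊥-elim)
open import Function using (_∘_; _⇔_; mk⇔; Equivalence)
open import Function.Construct.Composition using (_⇔-∘_)
open import Level using (0ℓ)
open import Algebra.Bundles using (CommutativeRing; CommutativeSemiring)
open import Algebra.Structures using (IsCommutativeRing)
open import Relation.Binary.PropositionalEquality
open import Relation.Nullary using (¬_)
open import Relation.Nullary.Decidable using (dec⇒maybe; decidable-stable)
open import Tactic.RingSolver.Core.AlmostCommutativeRing using (AlmostCommutativeRing; fromCommutativeRing)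

module SquareGaps where
  open import Data.Nat
  open import Data.Nat.Properties
  open import Data.Nat.Tactic.RingSolver using (solve-∀)
  open import Relation.Nullary.Decidable using (from-yes)

  no-square-between : ∀ n k → n * n < k * k → k * k < suc n * suc n → ⊥
  no-square-between n k n²<k² k²<[1+n]² = <⇒≱ k²<[1+n]² (*-mono-≤ n<k n<k)
    where
    n<k : n < k
    n<k = ≰⇒> λ k≤n → <⇒≱ n²<k² (*-mono-≤ k≤n k≤n)

  square≢square+4 : ∀ {t} k → 1 ≤ t → k * k ≢ t * t + 4
  square≢square+4 {1} k _ k²≡5 =
    no-square-between 2 k (subst (4 <_) (sym k²≡5) (from-yes (4 <? 5)))
                          (subst (_< 9) (sym k²≡5) (from-yes (5 <? 9)))
  square≢square+4 {t@(suc (suc j))} k _ k²≡t²+4 =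
    no-square-between t k (subst (t * t <_) (sym k²≡t²+4) (m<m+n (t * t) z<s))
                          (subst (_< suc t * suc t) (sym k²≡t²+4) t²+4<[1+t]²)
    where
    expand : ∀ j → let t = 2 + j in (1 + t) * (1 + t) ≡ t * t + 4 + (1 + 2 * j)
    expand = solve-∀
    t²+4<[1+t]² : t * t + 4 < suc t * suc t
    t²+4<[1+t]² = subst (t * t + 4 <_) (sym (expand j)) (m<m+n (t * t + 4) z<s)

  square+4≢square : ∀ {t} k → 3 ≤ t → k * k + 4 ≢ t * t
  square+4≢square {1} k (s≤s ())
  square+4≢square {2} k (s≤s (s≤s ()))
  square+4≢square {suc n@(suc (suc j))} k _ k²+4≡[1+n]² =
    no-square-between n k (subst (n * n <_) (sym k²≡n²+[1+2j]) (m<m+n (n * n) z<s))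
                          (subst (k * k <_) k²+4≡[1+n]² (m<m+n (k * k) z<s))
    where
    expand : ∀ j → let n = 2 + j in (1 + n) * (1 + n) ≡ n * n + (1 + 2 * j) + 4
    expand = solve-∀
    k²≡n²+[1+2j] : k * k ≡ n * n + (1 + 2 * j)
    k²≡n²+[1+2j] = +-cancelʳ-≡ 4 _ _ (trans k²+4≡[1+n]² (expand j))

  3≤t⇒4≤t² : ∀ {t} → 3 ≤ t → 4 ≤ t * t
  3≤t⇒4≤t² 3≤t = ≤-trans (from-yes (4 ≤? 9)) (*-mono-≤ 3≤t 3≤t)

  square≢square∸4 : ∀ {t} k → 3 ≤ t → k * k ≢ t * t ∸ 4
  square≢square∸4 k 3≤t k²≡t²∸4 = square+4≢square k 3≤t (trans (cong (_+ 4) k²≡t²∸4) (m∸n+n≡m (3≤t⇒4≤t² 3≤t)))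

module ContinuedFractionMatrices where
  open import Data.Nat
  open import Data.Nat.Properties
  open import Data.Nat.Tactic.RingSolver using (solve-∀)

  record Mat₂ : Set where
    constructor mat
    field
      m₁₁ m₁₂ m₂₁ m₂₂ : ℕ

  open Mat₂ public

  I₂ : Mat₂
  I₂ = mat 1 0 0 1

  -- mat a b c d = [[a, b], [c, d]];  x ◃ M = P x · M  and  M ▹ x = M · P x,
  -- where P x = [[0, 1], [1, x]] is the matrix of y ↦ 1 / (x + y).
  infixr 5 _◃_
  infixl 5 _▹_

  _◃_ : ℕ → Mat₂ → Mat₂
  x ◃ mat a b c d = mat c d (a + x * c) (b + x * d)

  _▹_ : Mat₂ → ℕ → Mat₂
  mat a b c d ▹ x = mat b (a + b * x) d (c + d * x)

  transpose : Mat₂ → Mat₂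
  transpose (mat a b c d) = mat a c b d

  cfMatrix : (n : ℕ) → (Fin n → ℕ) → Mat₂
  cfMatrix zero    c = I₂
  cfMatrix (suc n) c = c zero ◃ cfMatrix n (c ∘ suc)

  cfMatrix-cong : ∀ n {c c′ : Fin n → ℕ} → (∀ i → c i ≡ c′ i) → cfMatrix n c ≡ cfMatrix n c′
  cfMatrix-cong zero    c≗c′ = refl
  cfMatrix-cong (suc n) c≗c′ = cong₂ _◃_ (c≗c′ zero) (cfMatrix-cong n (c≗c′ ∘ suc))

  ◃-▹-assoc : ∀ x M y → x ◃ (M ▹ y) ≡ (x ◃ M) ▹ y
  ◃-▹-assoc x (mat a b c d) y = cong (mat d (c + d * y) (b + x * d)) (expand x y a b c d)
    where
    expand : ∀ x y a b c d → (a + b * y) + x * (c + d * y) ≡ (a + x * c) + (b + x * d) * y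
    expand = solve-∀

  cfMatrix-snoc : ∀ m (c : Fin (suc m) → ℕ) → cfMatrix (suc m) c ≡ cfMatrix m (c ∘ inject₁) ▹ c (fromℕ m)
  cfMatrix-snoc zero    c = cong₂ (mat 0 1) (cong suc (*-zeroʳ (c zero)))
                                            (trans (*-identityʳ (c zero)) (sym (+-identityʳ (c zero))))
  cfMatrix-snoc (suc m) c = begin
    c zero ◃ cfMatrix (suc m) (c ∘ suc)                              ≡⟨ cong (c zero ◃_) (cfMatrix-snoc m (c ∘ suc)) ⟩
    c zero ◃ (cfMatrix m (c ∘ suc ∘ inject₁) ▹ c (fromℕ (suc m)))   ≡⟨ ◃-▹-assoc (c zero) _ _ ⟩
    cfMatrix (suc m) (c ∘ inject₁) ▹ c (fromℕ (suc m))               ∎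
    where open ≡-Reasoning

  transpose-▹ : ∀ M x → transpose (M ▹ x) ≡ x ◃ transpose M
  transpose-▹ (mat a b c d) x = cong₂ (mat b d) (cong (a +_) (*-comm b x)) (cong (c +_) (*-comm d x))

  transpose-cfMatrix : ∀ m (c : Fin m → ℕ) → transpose (cfMatrix m c) ≡ cfMatrix m (c ∘ opposite)
  transpose-cfMatrix zero    c = refl
  transpose-cfMatrix (suc m) c = begin
    transpose (cfMatrix (suc m) c)                        ≡⟨ cong transpose (cfMatrix-snoc m c) ⟩
    transpose (cfMatrix m (c ∘ inject₁) ▹ c (fromℕ m))    ≡⟨ transpose-▹ _ _ ⟩
    c (fromℕ m) ◃ transpose (cfMatrix m (c ∘ inject₁))    ≡⟨ cong (c (fromℕ m) ◃_) (transpose-cfMatrix m (c ∘ inject₁)) ⟩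
    cfMatrix (suc m) (c ∘ opposite)                       ∎
    where open ≡-Reasoning

  record Ordered (M : Mat₂) : Set where
    field
      a≤b : m₁₁ M ≤ m₁₂ M
      b≤d : m₁₂ M ≤ m₂₂ M
      c≤d : m₂₁ M ≤ m₂₂ M
      1≤b : 1 ≤ m₁₂ M
      1≤c : 1 ≤ m₂₁ M

  ◃I-ordered : ∀ {x} → 1 ≤ x → Ordered (x ◃ I₂)
  ◃I-ordered {x} 1≤x rewrite *-zeroʳ x | *-identityʳ x = record
    { a≤b = z≤n ; b≤d = 1≤x ; c≤d = 1≤x ; 1≤b = ≤-refl ; 1≤c = ≤-refl }

  ◃-ordered : ∀ {x} M → 1 ≤ x → Ordered M → Ordered (x ◃ M)
  ◃-ordered {x} (mat a b c d) 1≤x o = record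
    { a≤b = c≤d
    ; b≤d = ≤-trans (m≤x*m d) (m≤n+m (x * d) b)
    ; c≤d = +-mono-≤ a≤b (*-monoʳ-≤ x c≤d)
    ; 1≤b = ≤-trans 1≤c c≤d
    ; 1≤c = ≤-trans 1≤c (≤-trans (m≤x*m c) (m≤n+m (x * c) a))
    }
    where
    open Ordered o
    m≤x*m : ∀ m → m ≤ x * m
    m≤x*m m = subst (_≤ x * m) (*-identityˡ m) (*-monoˡ-≤ m 1≤x)

  cfMatrix-ordered : ∀ n (c : Fin (suc n) → ℕ) → (∀ i → 1 ≤ c i) → Ordered (cfMatrix (suc n) c)
  cfMatrix-ordered zero    c pos = ◃I-ordered (pos zero)
  cfMatrix-ordered (suc n) c pos = ◃-ordered _ (pos zero) (cfMatrix-ordered n (c ∘ suc) (pos ∘ suc))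

  1≤cfMatrix₂₂ : ∀ n (c : Fin n → ℕ) → (∀ i → 1 ≤ c i) → 1 ≤ m₂₂ (cfMatrix n c)
  1≤cfMatrix₂₂ zero    c pos = ≤-refl
  1≤cfMatrix₂₂ (suc n) c pos = ≤-trans 1≤c c≤d
    where open Ordered (cfMatrix-ordered n c pos)

  cfMatrix-offDiagonal-bound : ∀ n (c : Fin n → ℕ) → (∀ i → 1 ≤ c i) → let M = cfMatrix n c in
                               m₁₂ M < m₂₂ M + m₂₁ M × m₂₁ M < m₂₂ M + m₁₂ M
  cfMatrix-offDiagonal-bound zero    c pos = s≤s z≤n , s≤s z≤n
  cfMatrix-offDiagonal-bound (suc n) c pos =
    subst (_≤ m₂₂ M + m₂₁ M) (+-comm (m₁₂ M) 1) (+-mono-≤ b≤d 1≤c) ,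
    subst (_≤ m₂₂ M + m₁₂ M) (+-comm (m₂₁ M) 1) (+-mono-≤ c≤d 1≤b)
    where
    M = cfMatrix (suc n) c
    open Ordered (cfMatrix-ordered n c pos)

  r+x*d≡r′+y*d⇒x≡y : ∀ {r r′ d} x y → 1 ≤ r → r ≤ d → 1 ≤ r′ → r′ ≤ d →
                     r + x * d ≡ r′ + y * d → x ≡ y
  r+x*d≡r′+y*d⇒x≡y zero    zero    _ _ _ _ _ = refl
  r+x*d≡r′+y*d⇒x≡y {r} {r′} {d} (suc x) (suc y) 1≤r r≤d 1≤r′ r′≤d eq =
    cong suc (r+x*d≡r′+y*d⇒x≡y x y 1≤r r≤d 1≤r′ r′≤d (+-cancelˡ-≡ d _ _ (begin
      d + (r + x * d)   ≡⟨ +-comm-swap d r _ ⟩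
      r + (d + x * d)   ≡⟨ eq ⟩
      r′ + (d + y * d)  ≡⟨ +-comm-swap r′ d _ ⟩
      d + (r′ + y * d)  ∎)))
    where
    open ≡-Reasoning
    +-comm-swap : ∀ m n o → m + (n + o) ≡ n + (m + o)
    +-comm-swap = solve-∀
  r+x*d≡r′+y*d⇒x≡y {r} {r′} {d} zero (suc y) _ r≤d 1≤r′ _ eq =
    ⊥-elim (<⇒≱ (subst (d <_) (sym (trans (sym (+-identityʳ r)) eq)) (+-mono-≤ 1≤r′ (m≤m+n d (y * d)))) r≤d)
  r+x*d≡r′+y*d⇒x≡y {r} {r′} {d} (suc x) zero 1≤r _ _ r′≤d eq =
    ⊥-elim (<⇒≱ (subst (d <_) (trans eq (+-identityʳ r′)) (+-mono-≤ 1≤r (m≤m+n d (x * d)))) r′≤d)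

  ◃I-injective : ∀ {x y} → x ◃ I₂ ≡ y ◃ I₂ → x ≡ y
  ◃I-injective {x} {y} eq = trans (sym (*-identityʳ x)) (trans (cong m₂₂ eq) (*-identityʳ y))

  ◃-injective : ∀ {x y} M M′ → Ordered M → Ordered M′ → x ◃ M ≡ y ◃ M′ → x ≡ y × M ≡ M′
  ◃-injective {x} {y} (mat a b c d) (mat a′ b′ c′ d′) o o′ eq with cong m₁₁ eq | cong m₁₂ eq
  ... | refl | refl = x≡y , cong₂ (λ a b → mat a b c d) a≡a′ b≡b′
    where
    x≡y : x ≡ y
    x≡y = r+x*d≡r′+y*d⇒x≡y x y (Ordered.1≤b o) (Ordered.b≤d o) (Ordered.1≤b o′) (Ordered.b≤d o′) (cong m₂₂ eq)
    a≡a′ : a ≡ a′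
    a≡a′ = +-cancelʳ-≡ (x * c) a a′ (trans (cong m₂₁ eq) (cong (λ z → a′ + z * c) (sym x≡y)))
    b≡b′ : b ≡ b′
    b≡b′ = +-cancelʳ-≡ (x * d) b b′ (trans (cong m₂₂ eq) (cong (λ z → b′ + z * d) (sym x≡y)))

  cfMatrix-injective : ∀ n {c c′ : Fin n → ℕ} → (∀ i → 1 ≤ c i) → (∀ i → 1 ≤ c′ i) →
                       cfMatrix n c ≡ cfMatrix n c′ → ∀ i → c i ≡ c′ i
  cfMatrix-injective 1 pos pos′ eq zero = ◃I-injective eq
  cfMatrix-injective (suc (suc n)) {c} {c′} pos pos′ eq i
    with ◃-injective {c zero} {c′ zero} _ _ (cfMatrix-ordered n (c ∘ suc) (pos ∘ suc))
                                             (cfMatrix-ordered n (c′ ∘ suc) (pos′ ∘ suc)) eq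
  ... | c₀≡c′₀ , tail≡tail′ with i
  ...   | zero  = c₀≡c′₀
  ...   | suc j = cfMatrix-injective (suc n) (pos ∘ suc) (pos′ ∘ suc) tail≡tail′ j

  symmetric⇔palindrome : ∀ m (c : Fin m → ℕ) → (∀ i → 1 ≤ c i) →
                         m₁₂ (cfMatrix m c) ≡ m₂₁ (cfMatrix m c) ⇔ (∀ j → c j ≡ c (opposite j))
  symmetric⇔palindrome m c pos = mk⇔ symmetric⇒palindrome palindrome⇒symmetric
    where
    symmetric⇒transpose-fixed : ∀ M → m₁₂ M ≡ m₂₁ M → M ≡ transpose M
    symmetric⇒transpose-fixed (mat a b .b d) refl = refl

    symmetric⇒palindrome : m₁₂ (cfMatrix m c) ≡ m₂₁ (cfMatrix m c) → ∀ j → c j ≡ c (opposite j)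
    symmetric⇒palindrome b≡c = cfMatrix-injective m pos (pos ∘ opposite)
      (trans (symmetric⇒transpose-fixed _ b≡c) (transpose-cfMatrix m c))

    palindrome⇒symmetric : (∀ j → c j ≡ c (opposite j)) → m₁₂ (cfMatrix m c) ≡ m₂₁ (cfMatrix m c)
    palindrome⇒symmetric pal = cong m₂₁ (trans (transpose-cfMatrix m c) (sym (cfMatrix-cong m pal)))

  Unimodular : Mat₂ → Set
  Unimodular (mat a b c d) = a * d ≡ b * c + 1 ⊎ b * c ≡ a * d + 1

  private
    +1-shift : ∀ {p q} r → p ≡ q + 1 → p + r ≡ q + r + 1
    +1-shift {q = q} r refl = trans (+-assoc q 1 r) (trans (cong (q +_) (+-comm 1 r)) (sym (+-assoc q r 1)))

  ◃-unimodular : ∀ x M → Unimodular M → Unimodular (x ◃ M)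
  ◃-unimodular x (mat a b c d) (inj₁ ad≡bc+1) =
    inj₂ (trans (expandʳ x a c d) (trans (+1-shift (x * c * d) ad≡bc+1) (cong (_+ 1) (sym (expandˡ x b c d)))))
    where
    expandʳ : ∀ x a c d → d * (a + x * c) ≡ a * d + x * c * d
    expandʳ = solve-∀
    expandˡ : ∀ x b c d → c * (b + x * d) ≡ b * c + x * c * d
    expandˡ = solve-∀
  ◃-unimodular x (mat a b c d) (inj₂ bc≡ad+1) =
    inj₁ (trans (expandˡ x b c d) (trans (+1-shift (x * c * d) bc≡ad+1) (cong (_+ 1) (sym (expandʳ x a c d)))))
    where
    expandʳ : ∀ x a c d → d * (a + x * c) ≡ a * d + x * c * d
    expandʳ = solve-∀
    expandˡ : ∀ x b c d → c * (b + x * d) ≡ b * c + x * c * d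
    expandˡ = solve-∀

  cfMatrix-unimodular : ∀ n (c : Fin n → ℕ) → Unimodular (cfMatrix n c)
  cfMatrix-unimodular zero    c = inj₁ refl
  cfMatrix-unimodular (suc n) c = ◃-unimodular (c zero) (cfMatrix n (c ∘ suc)) (cfMatrix-unimodular n (c ∘ suc))

  -- Trace bounds under which the discriminant (a + d)² - 4(ad - bc) = (a + d)² ∓ 4 is not a square.
  Hyperbolic : Mat₂ → Set
  Hyperbolic (mat a b c d) = (a * d ≡ b * c + 1 × 3 ≤ a + d) ⊎ (b * c ≡ a * d + 1 × 1 ≤ a + d)

  ▹-hyperbolic : ∀ M {x} → 1 ≤ x → 1 ≤ m₂₂ M → Unimodular M → Hyperbolic (M ▹ x)
  ▹-hyperbolic (mat a b c d) {x} 1≤x 1≤d (inj₁ ad≡bc+1) =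
    inj₂ (trans (expandᵇᶜ a b d x) (trans (+1-shift (b * d * x) ad≡bc+1) (cong (_+ 1) (sym (expandᵃᵈ b c d x)))) ,
          ≤-trans (*-mono-≤ 1≤d 1≤x) (≤-trans (m≤n+m (d * x) c) (m≤n+m (c + d * x) b)))
    where
    expandᵇᶜ : ∀ a b d x → (a + b * x) * d ≡ a * d + b * d * x
    expandᵇᶜ = solve-∀
    expandᵃᵈ : ∀ b c d x → b * (c + d * x) ≡ b * c + b * d * x
    expandᵃᵈ = solve-∀
  ▹-hyperbolic (mat a b c d) {x} 1≤x 1≤d (inj₂ bc≡ad+1) =
    inj₁ (trans (expandᵃᵈ b c d x) (trans (+1-shift (b * d * x) bc≡ad+1) (cong (_+ 1) (sym (expandᵇᶜ a b d x)))) ,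
          +-mono-≤ 1≤b (+-mono-≤ 1≤c (*-mono-≤ 1≤d 1≤x)))
    where
    expandᵇᶜ : ∀ a b d x → (a + b * x) * d ≡ a * d + b * d * x
    expandᵇᶜ = solve-∀
    expandᵃᵈ : ∀ b c d x → b * (c + d * x) ≡ b * c + b * d * x
    expandᵃᵈ = solve-∀
    factors-positive : ∀ m n {k} → m * n ≡ suc k → 1 ≤ m × 1 ≤ n
    factors-positive (suc m) (suc n) _  = s≤s z≤n , s≤s z≤n
    factors-positive (suc m) zero    eq = ⊥-elim (0≢1+n (trans (sym (*-zeroʳ m)) eq))
    1≤b×1≤c : 1 ≤ b × 1 ≤ c
    1≤b×1≤c = factors-positive b c (trans bc≡ad+1 (+-comm (a * d) 1))
    1≤b = proj₁ 1≤b×1≤c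
    1≤c = proj₂ 1≤b×1≤c

  cfMatrix-hyperbolic : ∀ m (c : Fin (suc m) → ℕ) → (∀ i → 1 ≤ c i) → Hyperbolic (cfMatrix (suc m) c)
  cfMatrix-hyperbolic m c pos = subst Hyperbolic (sym (cfMatrix-snoc m c))
    (▹-hyperbolic (cfMatrix m (c ∘ inject₁)) (pos (fromℕ m)) (1≤cfMatrix₂₂ m (c ∘ inject₁) (pos ∘ inject₁))
                  (cfMatrix-unimodular m (c ∘ inject₁)))

open SquareGaps
open ContinuedFractionMatrices

module MöbiusRelation {c ℓ} (R : CommutativeSemiring c ℓ) (ι : ℕ → CommutativeSemiring.Carrier R) where
  private module R = CommutativeSemiring R
  open R using (Carrier; _≈_; _+_; _*_; 0#; 1#; +-cong; +-congʳ; *-congˡ; *-congʳ; *-identityˡ)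
  open import Relation.Binary.Reasoning.Setoid R.setoid
  open import Algebra.Solver.Ring.NaturalCoefficients.Default R

  Möbius : Mat₂ → Carrier → Carrier → Set ℓ
  Möbius (mat a b c d) x y = x * (ι c * y + ι d) ≈ ι a * y + ι b

  module _ (ι-0 : ι 0 ≈ 0#) (ι-1 : ι 1 ≈ 1#) (ι-affine : ∀ a x c → ι (a ℕ.+ x ℕ.* c) ≈ ι a + ι x * ι c) where

    möbius-I₂ : ∀ x → Möbius I₂ x x
    möbius-I₂ x = begin
      x * (ι 0 * x + ι 1)  ≈⟨ *-congˡ (+-cong (*-congʳ ι-0) ι-1) ⟩
      x * (0# * x + 1#)    ≈⟨ solve 1 (λ x → x :* (con 0 :* x :+ con 1) := con 1 :* x :+ con 0) R.refl x ⟩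
      1# * x + 0#          ≈⟨ R.sym (+-cong (*-congʳ ι-1) ι-0) ⟩
      ι 1 * x + ι 0        ∎

    ◃-möbius : ∀ k M {x y z} → x * (ι k + y) ≈ 1# → Möbius M y z → Möbius (k ◃ M) x z
    ◃-möbius k (mat a b c d) {x} {y} {z} x[k+y]≈1 y≈Mz = begin
      x * (ι (a ℕ.+ k ℕ.* c) * z + ι (b ℕ.+ k ℕ.* d))          ≈⟨ *-congˡ (+-cong (*-congʳ (ι-affine a k c)) (ι-affine b k d)) ⟩
      x * ((ι a + ι k * ι c) * z + (ι b + ι k * ι d))          ≈⟨ regroup x z (ι k) (ι a) (ι b) (ι c) (ι d) ⟩
      x * (ι a * z + ι b) + ι k * (x * (ι c * z + ι d))        ≈⟨ +-congʳ (*-congˡ (R.sym y≈Mz)) ⟩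
      x * (y * (ι c * z + ι d)) + ι k * (x * (ι c * z + ι d))  ≈⟨ factor x y (ι k) (ι c * z + ι d) ⟩
      x * (ι k + y) * (ι c * z + ι d)                          ≈⟨ *-congʳ x[k+y]≈1 ⟩
      1# * (ι c * z + ι d)                                     ≈⟨ *-identityˡ _ ⟩
      ι c * z + ι d                                            ∎
      where
      regroup : ∀ x z k a b c d → x * ((a + k * c) * z + (b + k * d)) ≈ x * (a * z + b) + k * (x * (c * z + d))
      regroup = solve 7 (λ x z k a b c d → x :* ((a :+ k :* c) :* z :+ (b :+ k :* d))
                                        := x :* (a :* z :+ b) :+ k :* (x :* (c :* z :+ d))) R.refl
      factor : ∀ x y k w → x * (y * w) + k * (x * w) ≈ x * (k + y) * w
      factor = solve 4 (λ x y k w → x :* (y :* w) :+ k :* (x :* w) := x :* (k :+ y) :* w) R.refl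

    cfMatrix-möbius : ∀ n (c : Fin n → ℕ) (t : Fin (suc n) → Carrier) →
                      (∀ i → t (inject₁ i) * (ι (c i) + t (suc i)) ≈ 1#) → Möbius (cfMatrix n c) (t zero) (t (fromℕ n))
    cfMatrix-möbius zero    c t steps = möbius-I₂ (t zero)
    cfMatrix-möbius (suc n) c t steps =
      ◃-möbius (c zero) (cfMatrix n (c ∘ suc)) (steps zero) (cfMatrix-möbius n (c ∘ suc) (t ∘ suc) (steps ∘ suc))

open import Data.Integer using (ℤ; +_; +[1+_]; -[1+_])
open import Tactic.RingSolver using (solve-∀)
import Data.Integer.Tactic.RingSolver as ℤ-Solver
open import Algebra.Properties.Group ℚ.+-0-group
  using ()
  renaming ( x≈y⇒x∙y⁻¹≈ε to p≡q⇒p-q≡0 ; x∙y⁻¹≈ε⇒x≈y to p-q≡0⇒p≡q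
           ; inverseˡ-unique to p+q≡0⇒p≡-q ; identityˡ-unique to p+q≡q⇒p≡0 )
open import Data.Rational using (ℚ; mkℚ; _+_; _*_; -_; _-_; 0ℚ; 1ℚ; 1/_; ↥_; ↧_)

ℚ-ring : AlmostCommutativeRing 0ℓ 0ℓ
ℚ-ring = fromCommutativeRing ℚ.+-*-commutativeRing (dec⇒maybe ∘ (0ℚ ℚ.≟_))

ℤ→ℚ≡mkℚ : ∀ z → ℤ→ℚ z ≡ mkℚ z 0 (Coprimality.sym (Coprimality.1-coprimeTo _))
ℤ→ℚ≡mkℚ z = ℚ.↥p/↧p≡p (mkℚ z 0 (Coprimality.sym (Coprimality.1-coprimeTo _)))

ℤ→ℚ-homo-+ : ∀ m n → ℤ→ℚ (m ℤ.+ n) ≡ ℤ→ℚ m + ℤ→ℚ n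
ℤ→ℚ-homo-+ m n rewrite ℤ→ℚ≡mkℚ m | ℤ→ℚ≡mkℚ n =
  ℚ./-cong {m ℤ.+ n} {1} (cong₂ ℤ._+_ (sym (ℤ.*-identityʳ m)) (sym (ℤ.*-identityʳ n))) refl

ℤ→ℚ-homo-* : ∀ m n → ℤ→ℚ (m ℤ.* n) ≡ ℤ→ℚ m * ℤ→ℚ n
ℤ→ℚ-homo-* m n rewrite ℤ→ℚ≡mkℚ m | ℤ→ℚ≡mkℚ n = refl

ℤ→ℚ-neg-ℕ : ∀ n → ℤ→ℚ (ℤ.- + n) ≡ - ℕ→ℚ n
ℤ→ℚ-neg-ℕ zero    = refl
ℤ→ℚ-neg-ℕ (suc n) = refl

ℤ→ℚ-injective : ∀ {m n} → ℤ→ℚ m ≡ ℤ→ℚ n → m ≡ n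
ℤ→ℚ-injective {m} {n} eq = cong ↥_ (trans (sym (ℤ→ℚ≡mkℚ m)) (trans eq (ℤ→ℚ≡mkℚ n)))

ℕ→ℚ-homo-+ : ∀ m n → ℕ→ℚ (m ℕ.+ n) ≡ ℕ→ℚ m + ℕ→ℚ n
ℕ→ℚ-homo-+ m n = ℤ→ℚ-homo-+ (+ m) (+ n)

ℕ→ℚ-homo-* : ∀ m n → ℕ→ℚ (m ℕ.* n) ≡ ℕ→ℚ m * ℕ→ℚ n
ℕ→ℚ-homo-* m n = trans (cong ℤ→ℚ (ℤ.pos-* m n)) (ℤ→ℚ-homo-* (+ m) (+ n))

ℕ→ℚ-homo-∸ : ∀ {m n} → n ≤ m → ℕ→ℚ (m ℕ.∸ n) ≡ ℕ→ℚ m - ℕ→ℚ n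
ℕ→ℚ-homo-∸ {m} {n} n≤m = begin
  ℕ→ℚ (m ℕ.∸ n)                          ≡⟨ add-sub (ℕ→ℚ (m ℕ.∸ n)) (ℕ→ℚ n) ⟩
  ℕ→ℚ (m ℕ.∸ n) + ℕ→ℚ n - ℕ→ℚ n          ≡⟨ cong (_- ℕ→ℚ n) (sym (ℕ→ℚ-homo-+ (m ℕ.∸ n) n)) ⟩
  ℕ→ℚ (m ℕ.∸ n ℕ.+ n) - ℕ→ℚ n            ≡⟨ cong (λ k → ℕ→ℚ k - ℕ→ℚ n) (ℕ.m∸n+n≡m n≤m) ⟩
  ℕ→ℚ m - ℕ→ℚ n                          ∎
  where
  open ≡-Reasoning
  add-sub : ∀ p q → p ≡ p + q - q
  add-sub = solve-∀ ℚ-ring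

ℕ→ℚ-injective : ∀ {m n} → ℕ→ℚ m ≡ ℕ→ℚ n → m ≡ n
ℕ→ℚ-injective = ℤ.+-injective ∘ ℤ→ℚ-injective

ℕ→ℚ-≢0 : ∀ {n} → 1 ≤ n → ℕ→ℚ n ≢ 0ℚ
ℕ→ℚ-≢0 {suc n} _ eq with ℕ→ℚ-injective {suc n} {0} eq
... | ()

p*q≡0⇒q≡0 : ∀ {p q} → p ≢ 0ℚ → p * q ≡ 0ℚ → q ≡ 0ℚ
p*q≡0⇒q≡0 {p} {q} p≢0 pq≡0 = begin
  q                ≡⟨ sym (ℚ.*-identityˡ q) ⟩
  1ℚ * q           ≡⟨ cong (_* q) (sym (ℚ.*-inverseˡ p)) ⟩
  (1/ p) * p * q   ≡⟨ ℚ.*-assoc (1/ p) p q ⟩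
  (1/ p) * (p * q) ≡⟨ cong ((1/ p) *_) pq≡0 ⟩
  (1/ p) * 0ℚ      ≡⟨ ℚ.*-zeroʳ (1/ p) ⟩
  0ℚ               ∎
  where
  open ≡-Reasoning
  instance _ = ℚ.≢-nonZero p≢0

p*q≢0 : ∀ {p q} → p ≢ 0ℚ → q ≢ 0ℚ → p * q ≢ 0ℚ
p*q≢0 p≢0 q≢0 = q≢0 ∘ p*q≡0⇒q≡0 p≢0

-- With r = n/d in lowest terms, n² = N d² forces d ∣ n, hence d = 1.
ℕ→ℚ-square⇒square : ∀ {N} r → r * r ≡ ℕ→ℚ N → ∃ λ k → k ℕ.* k ≡ N
ℕ→ℚ-square⇒square {N} (mkℚ n d-1 n⊥d) r²≡N = ∣n∣ , ∣n∣²≡N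
  where
  ∣n∣ = ℤ.∣ n ∣
  d = suc d-1
  D = d ℕ.* d
  n²/D≡N : (n ℤ.* n) ℚ./ D ≡ mkℚ (+ N) 0 _
  n²/D≡N = trans r²≡N (ℤ→ℚ≡mkℚ (+ N))
  g = ℤ.gcd (n ℤ.* n) (+ D)
  N*g≡n² : + N ℤ.* g ≡ n ℤ.* n
  N*g≡n² = trans (cong (λ q → ↥ q ℤ.* g) (sym n²/D≡N)) (ℚ.↥-/ (n ℤ.* n) D)
  g≡D : g ≡ + D
  g≡D = trans (sym (ℤ.*-identityˡ g)) (trans (cong (λ q → ↧ q ℤ.* g) (sym n²/D≡N)) (ℚ.↧-/ (n ℤ.* n) D))
  N*D≡∣n∣² : N ℕ.* D ≡ ∣n∣ ℕ.* ∣n∣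
  N*D≡∣n∣² = trans (sym (ℤ.abs-* (+ N) (+ D))) (trans (cong (ℤ.∣_∣ ∘ (+ N ℤ.*_)) (sym g≡D))
                   (trans (cong ℤ.∣_∣ N*g≡n²) (ℤ.abs-* n n)))
  d∣∣n∣ : d ∣ ∣n∣
  d∣∣n∣ = Coprimality.coprime-divisor (Coprimality.sym (Coprimality.recompute n⊥d))
            (divides (N ℕ.* d) (trans (sym N*D≡∣n∣²) (sym (ℕ.*-assoc N d d))))
  d≡1 : d ≡ 1
  d≡1 = Coprimality.recompute n⊥d (d∣∣n∣ , ∣-refl)
  ∣n∣²≡N : ∣n∣ ℕ.* ∣n∣ ≡ N
  ∣n∣²≡N = trans (sym N*D≡∣n∣²) (trans (cong (λ k → N ℕ.* (k ℕ.* k)) d≡1) (ℕ.*-identityʳ N))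

discriminant : Mat₂ → ℚ
discriminant (mat a b c d) = (ℕ→ℚ d - ℕ→ℚ a) * (ℕ→ℚ d - ℕ→ℚ a) + ℕ→ℚ 4 * (ℕ→ℚ b * ℕ→ℚ c)

private
  ℕ→ℚ-homo-*+1 : ∀ p q r s → p ℕ.* q ≡ r ℕ.* s ℕ.+ 1 → ℕ→ℚ p * ℕ→ℚ q ≡ ℕ→ℚ r * ℕ→ℚ s + 1ℚ
  ℕ→ℚ-homo-*+1 p q r s pq≡rs+1 = begin
    ℕ→ℚ p * ℕ→ℚ q         ≡⟨ sym (ℕ→ℚ-homo-* p q) ⟩
    ℕ→ℚ (p ℕ.* q)         ≡⟨ cong ℕ→ℚ pq≡rs+1 ⟩
    ℕ→ℚ (r ℕ.* s ℕ.+ 1)   ≡⟨ ℕ→ℚ-homo-+ (r ℕ.* s) 1 ⟩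
    ℕ→ℚ (r ℕ.* s) + 1ℚ    ≡⟨ cong (_+ 1ℚ) (ℕ→ℚ-homo-* r s) ⟩
    ℕ→ℚ r * ℕ→ℚ s + 1ℚ    ∎
    where open ≡-Reasoning

  ℕ→ℚ-homo-square : ∀ a d → ℕ→ℚ ((a ℕ.+ d) ℕ.* (a ℕ.+ d)) ≡ (ℕ→ℚ a + ℕ→ℚ d) * (ℕ→ℚ a + ℕ→ℚ d)
  ℕ→ℚ-homo-square a d = trans (ℕ→ℚ-homo-* (a ℕ.+ d) (a ℕ.+ d)) (cong₂ _*_ (ℕ→ℚ-homo-+ a d) (ℕ→ℚ-homo-+ a d))

  discriminant-trace-det : ∀ a b c d → let A = ℕ→ℚ a ; B = ℕ→ℚ b ; C = ℕ→ℚ c ; D = ℕ→ℚ d in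
    discriminant (mat a b c d) ≡ (A + D) * (A + D) - ℕ→ℚ 4 * (A * D) + ℕ→ℚ 4 * (B * C)
  discriminant-trace-det a b c d = expand (ℕ→ℚ a) (ℕ→ℚ b) (ℕ→ℚ c) (ℕ→ℚ d)
    where
    expand : ∀ A B C D → (D - A) * (D - A) + ℕ→ℚ 4 * (B * C) ≡ (A + D) * (A + D) - ℕ→ℚ 4 * (A * D) + ℕ→ℚ 4 * (B * C)
    expand = solve-∀ ℚ-ring

  discriminant-det+1 : ∀ a b c d → a ℕ.* d ≡ b ℕ.* c ℕ.+ 1 → 4 ≤ (a ℕ.+ d) ℕ.* (a ℕ.+ d) →
                       discriminant (mat a b c d) ≡ ℕ→ℚ ((a ℕ.+ d) ℕ.* (a ℕ.+ d) ℕ.∸ 4)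
  discriminant-det+1 a b c d ad≡bc+1 4≤t² = begin
    discriminant (mat a b c d)                                  ≡⟨ discriminant-trace-det a b c d ⟩
    (A + D) * (A + D) - ℕ→ℚ 4 * (A * D) + ℕ→ℚ 4 * (B * C)       ≡⟨ cong (λ x → (A + D) * (A + D) - ℕ→ℚ 4 * x + ℕ→ℚ 4 * (B * C))
                                                                        (ℕ→ℚ-homo-*+1 a d b c ad≡bc+1) ⟩
    (A + D) * (A + D) - ℕ→ℚ 4 * (B * C + 1ℚ) + ℕ→ℚ 4 * (B * C)  ≡⟨ simplify (A + D) (B * C) ⟩
    (A + D) * (A + D) - ℕ→ℚ 4                                   ≡⟨ cong (_- ℕ→ℚ 4) (sym (ℕ→ℚ-homo-square a d)) ⟩
    ℕ→ℚ ((a ℕ.+ d) ℕ.* (a ℕ.+ d)) - ℕ→ℚ 4                       ≡⟨ sym (ℕ→ℚ-homo-∸ 4≤t²) ⟩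
    ℕ→ℚ ((a ℕ.+ d) ℕ.* (a ℕ.+ d) ℕ.∸ 4)                         ∎
    where
    open ≡-Reasoning
    A = ℕ→ℚ a ; B = ℕ→ℚ b ; C = ℕ→ℚ c ; D = ℕ→ℚ d
    simplify : ∀ T P → T * T - ℕ→ℚ 4 * (P + 1ℚ) + ℕ→ℚ 4 * P ≡ T * T - ℕ→ℚ 4
    simplify = solve-∀ ℚ-ring

  discriminant-det-1 : ∀ a b c d → b ℕ.* c ≡ a ℕ.* d ℕ.+ 1 →
                       discriminant (mat a b c d) ≡ ℕ→ℚ ((a ℕ.+ d) ℕ.* (a ℕ.+ d) ℕ.+ 4)
  discriminant-det-1 a b c d bc≡ad+1 = begin
    discriminant (mat a b c d)                                  ≡⟨ discriminant-trace-det a b c d ⟩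
    (A + D) * (A + D) - ℕ→ℚ 4 * (A * D) + ℕ→ℚ 4 * (B * C)       ≡⟨ cong (λ x → (A + D) * (A + D) - ℕ→ℚ 4 * (A * D) + ℕ→ℚ 4 * x)
                                                                        (ℕ→ℚ-homo-*+1 b c a d bc≡ad+1) ⟩
    (A + D) * (A + D) - ℕ→ℚ 4 * (A * D) + ℕ→ℚ 4 * (A * D + 1ℚ)  ≡⟨ simplify (A + D) (A * D) ⟩
    (A + D) * (A + D) + ℕ→ℚ 4                                   ≡⟨ cong (_+ ℕ→ℚ 4) (sym (ℕ→ℚ-homo-square a d)) ⟩
    ℕ→ℚ ((a ℕ.+ d) ℕ.* (a ℕ.+ d)) + ℕ→ℚ 4                       ≡⟨ sym (ℕ→ℚ-homo-+ ((a ℕ.+ d) ℕ.* (a ℕ.+ d)) 4) ⟩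
    ℕ→ℚ ((a ℕ.+ d) ℕ.* (a ℕ.+ d) ℕ.+ 4)                         ∎
    where
    open ≡-Reasoning
    A = ℕ→ℚ a ; B = ℕ→ℚ b ; C = ℕ→ℚ c ; D = ℕ→ℚ d
    simplify : ∀ T P → T * T - ℕ→ℚ 4 * P + ℕ→ℚ 4 * (P + 1ℚ) ≡ T * T + ℕ→ℚ 4
    simplify = solve-∀ ℚ-ring

hyperbolic⇒discriminant-nonsquare : ∀ M → Hyperbolic M → ¬ IsSquareℚ (discriminant M)
hyperbolic⇒discriminant-nonsquare (mat a b c d) (inj₁ (ad≡bc+1 , 3≤t)) (r , r²≡Δ)
  with ℕ→ℚ-square⇒square r (trans r²≡Δ (discriminant-det+1 a b c d ad≡bc+1 (3≤t⇒4≤t² 3≤t)))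
... | k , k²≡t²∸4 = square≢square∸4 k 3≤t k²≡t²∸4
hyperbolic⇒discriminant-nonsquare (mat a b c d) (inj₂ (bc≡ad+1 , 1≤t)) (r , r²≡Δ)
  with ℕ→ℚ-square⇒square r (trans r²≡Δ (discriminant-det-1 a b c d bc≡ad+1))
... | k , k²≡t²+4 = square≢square+4 k 1≤t k²≡t²+4

-- The quadratic field ℚ(√b)

Irrational : Qsqrt → Set
Irrational x = proj₂ x ≢ 0ℚ

1/p≢0 : ∀ p .{{_ : ℚ.NonZero p}} → 1/ p ≢ 0ℚ
1/p≢0 p 1/p≡0 = ℚ.1≢0 (begin
  1ℚ          ≡⟨ sym (ℚ.*-inverseʳ p) ⟩
  p * (1/ p)  ≡⟨ cong (p *_) 1/p≡0 ⟩
  p * 0ℚ      ≡⟨ ℚ.*-zeroʳ p ⟩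
  0ℚ          ∎)
  where open ≡-Reasoning

module QuadraticField (b : ℚ) where

  infixl 6 _⊕ᵇ_
  infixl 7 _⊗ᵇ_
  infix  8 ⊖ᵇ_

  _⊕ᵇ_ : Qsqrt → Qsqrt → Qsqrt
  _⊕ᵇ_ = _⊕_ b

  _⊗ᵇ_ : Qsqrt → Qsqrt → Qsqrt
  _⊗ᵇ_ = _⊗_ b

  ⊖ᵇ_ : Qsqrt → Qsqrt
  ⊖ᵇ (u , v) = (- u , - v)

  0ᵇ : Qsqrt
  0ᵇ = (0ℚ , 0ℚ)

  ⊕-assoc : ∀ x y z → (x ⊕ᵇ y) ⊕ᵇ z ≡ x ⊕ᵇ (y ⊕ᵇ z)
  ⊕-assoc (u , v) (u′ , v′) (u″ , v″) = cong₂ _,_ (ℚ.+-assoc u u′ u″) (ℚ.+-assoc v v′ v″)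

  ⊕-comm : ∀ x y → x ⊕ᵇ y ≡ y ⊕ᵇ x
  ⊕-comm (u , v) (u′ , v′) = cong₂ _,_ (ℚ.+-comm u u′) (ℚ.+-comm v v′)

  ⊕-identityˡ : ∀ x → 0ᵇ ⊕ᵇ x ≡ x
  ⊕-identityˡ (u , v) = cong₂ _,_ (ℚ.+-identityˡ u) (ℚ.+-identityˡ v)

  ⊕-identityʳ : ∀ x → x ⊕ᵇ 0ᵇ ≡ x
  ⊕-identityʳ (u , v) = cong₂ _,_ (ℚ.+-identityʳ u) (ℚ.+-identityʳ v)

  ⊕-inverseˡ : ∀ x → ⊖ᵇ x ⊕ᵇ x ≡ 0ᵇ
  ⊕-inverseˡ (u , v) = cong₂ _,_ (ℚ.+-inverseˡ u) (ℚ.+-inverseˡ v)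

  ⊕-inverseʳ : ∀ x → x ⊕ᵇ ⊖ᵇ x ≡ 0ᵇ
  ⊕-inverseʳ (u , v) = cong₂ _,_ (ℚ.+-inverseʳ u) (ℚ.+-inverseʳ v)

  ⊗-assoc : ∀ x y z → (x ⊗ᵇ y) ⊗ᵇ z ≡ x ⊗ᵇ (y ⊗ᵇ z)
  ⊗-assoc (u , v) (u′ , v′) (u″ , v″) = cong₂ _,_ (rational b u v u′ v′ u″ v″) (irrational b u v u′ v′ u″ v″)
    where
    rational : ∀ b u v u′ v′ u″ v″ →
      (u * u′ + b * (v * v′)) * u″ + b * ((u * v′ + v * u′) * v″) ≡ u * (u′ * u″ + b * (v′ * v″)) + b * (v * (u′ * v″ + v′ * u″))
    rational = solve-∀ ℚ-ring
    irrational : ∀ b u v u′ v′ u″ v″ →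
      (u * u′ + b * (v * v′)) * v″ + (u * v′ + v * u′) * u″ ≡ u * (u′ * v″ + v′ * u″) + v * (u′ * u″ + b * (v′ * v″))
    irrational = solve-∀ ℚ-ring

  ⊗-comm : ∀ x y → x ⊗ᵇ y ≡ y ⊗ᵇ x
  ⊗-comm (u , v) (u′ , v′) = cong₂ _,_ (rational b u v u′ v′) (irrational u v u′ v′)
    where
    rational : ∀ b u v u′ v′ → u * u′ + b * (v * v′) ≡ u′ * u + b * (v′ * v)
    rational = solve-∀ ℚ-ring
    irrational : ∀ u v u′ v′ → u * v′ + v * u′ ≡ u′ * v + v′ * u
    irrational = solve-∀ ℚ-ring

  ⊗-identityˡ : ∀ x → oneQ ⊗ᵇ x ≡ x
  ⊗-identityˡ (u , v) = cong₂ _,_ (rational b u v) (irrational u v)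
    where
    rational : ∀ b u v → 1ℚ * u + b * (0ℚ * v) ≡ u
    rational = solve-∀ ℚ-ring
    irrational : ∀ u v → 1ℚ * v + 0ℚ * u ≡ v
    irrational = solve-∀ ℚ-ring

  ⊗-identityʳ : ∀ x → x ⊗ᵇ oneQ ≡ x
  ⊗-identityʳ x = trans (⊗-comm x oneQ) (⊗-identityˡ x)

  ⊗-distribˡ-⊕ : ∀ x y z → x ⊗ᵇ (y ⊕ᵇ z) ≡ x ⊗ᵇ y ⊕ᵇ x ⊗ᵇ z
  ⊗-distribˡ-⊕ (u , v) (u′ , v′) (u″ , v″) = cong₂ _,_ (rational b u v u′ v′ u″ v″) (irrational u v u′ v′ u″ v″)
    where
    rational : ∀ b u v u′ v′ u″ v″ →
      u * (u′ + u″) + b * (v * (v′ + v″)) ≡ (u * u′ + b * (v * v′)) + (u * u″ + b * (v * v″))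
    rational = solve-∀ ℚ-ring
    irrational : ∀ u v u′ v′ u″ v″ → u * (v′ + v″) + v * (u′ + u″) ≡ (u * v′ + v * u′) + (u * v″ + v * u″)
    irrational = solve-∀ ℚ-ring

  ⊗-distribʳ-⊕ : ∀ x y z → (y ⊕ᵇ z) ⊗ᵇ x ≡ y ⊗ᵇ x ⊕ᵇ z ⊗ᵇ x
  ⊗-distribʳ-⊕ x y z = begin
    (y ⊕ᵇ z) ⊗ᵇ x       ≡⟨ ⊗-comm (y ⊕ᵇ z) x ⟩
    x ⊗ᵇ (y ⊕ᵇ z)       ≡⟨ ⊗-distribˡ-⊕ x y z ⟩
    x ⊗ᵇ y ⊕ᵇ x ⊗ᵇ z    ≡⟨ cong₂ _⊕ᵇ_ (⊗-comm x y) (⊗-comm x z) ⟩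
    y ⊗ᵇ x ⊕ᵇ z ⊗ᵇ x    ∎
    where open ≡-Reasoning

  isCommutativeRing : IsCommutativeRing _≡_ _⊕ᵇ_ _⊗ᵇ_ ⊖ᵇ_ 0ᵇ oneQ
  isCommutativeRing = record
    { isRing = record
      { +-isAbelianGroup = record
        { isGroup = record
          { isMonoid = record
            { isSemigroup = record
              { isMagma = record { isEquivalence = isEquivalence ; ∙-cong = cong₂ _⊕ᵇ_ }
              ; assoc = ⊕-assoc
              }
            ; identity = ⊕-identityˡ , ⊕-identityʳ
            }
          ; inverse = ⊕-inverseˡ , ⊕-inverseʳ
          ; ⁻¹-cong = cong ⊖ᵇ_
          }
        ; comm = ⊕-comm
        }
      ; *-cong = cong₂ _⊗ᵇ_
      ; *-assoc = ⊗-assoc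
      ; *-identity = ⊗-identityˡ , ⊗-identityʳ
      ; distrib = ⊗-distribˡ-⊕ , ⊗-distribʳ-⊕
      }
    ; *-comm = ⊗-comm
    }

  commutativeRing : CommutativeRing 0ℓ 0ℓ
  commutativeRing = record { isCommutativeRing = isCommutativeRing }

  embℕ-homo-affine : ∀ a x c → embℕ (a ℕ.+ x ℕ.* c) ≡ embℕ a ⊕ᵇ embℕ x ⊗ᵇ embℕ c
  embℕ-homo-affine a x c = cong₂ _,_ rational (irrational (ℕ→ℚ x) (ℕ→ℚ c))
    where
    rational : ℕ→ℚ (a ℕ.+ x ℕ.* c) ≡ ℕ→ℚ a + (ℕ→ℚ x * ℕ→ℚ c + b * (0ℚ * 0ℚ))
    rational = begin
      ℕ→ℚ (a ℕ.+ x ℕ.* c)                          ≡⟨ ℕ→ℚ-homo-+ a (x ℕ.* c) ⟩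
      ℕ→ℚ a + ℕ→ℚ (x ℕ.* c)                        ≡⟨ cong (_+_ (ℕ→ℚ a)) (ℕ→ℚ-homo-* x c) ⟩
      ℕ→ℚ a + ℕ→ℚ x * ℕ→ℚ c                        ≡⟨ cong (_+_ (ℕ→ℚ a)) (drop-zero b (ℕ→ℚ x * ℕ→ℚ c)) ⟩
      ℕ→ℚ a + (ℕ→ℚ x * ℕ→ℚ c + b * (0ℚ * 0ℚ))      ∎
      where
      open ≡-Reasoning
      drop-zero : ∀ b p → p ≡ p + b * (0ℚ * 0ℚ)
      drop-zero = solve-∀ ℚ-ring
    irrational : ∀ p q → 0ℚ ≡ 0ℚ + (p * 0ℚ + 0ℚ * q)
    irrational = solve-∀ ℚ-ring

  private module Semiring = MöbiusRelation (CommutativeRing.commutativeSemiring commutativeRing) embℕ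

  open Semiring public using (Möbius)

  cfMatrix-möbius : ∀ n (c : Fin n → ℕ) (t : Fin (suc n) → Qsqrt) →
                    (∀ i → t (inject₁ i) ⊗ᵇ (embℕ (c i) ⊕ᵇ t (suc i)) ≡ oneQ) →
                    Möbius (cfMatrix n c) (t zero) (t (fromℕ n))
  cfMatrix-möbius = Semiring.cfMatrix-möbius refl refl embℕ-homo-affine

  embℕ-affine : ∀ p q u v → embℕ p ⊗ᵇ (u , v) ⊕ᵇ embℕ q ≡ (ℕ→ℚ p * u + ℕ→ℚ q , ℕ→ℚ p * v)
  embℕ-affine p q u v = cong₂ _,_ (rational b (ℕ→ℚ p) (ℕ→ℚ q) u v) (irrational (ℕ→ℚ p) u v)
    where
    rational : ∀ b p q u v → p * u + b * (0ℚ * v) + q ≡ p * u + q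
    rational = solve-∀ ℚ-ring
    irrational : ∀ p u v → p * v + 0ℚ * u + 0ℚ ≡ p * v
    irrational = solve-∀ ℚ-ring

  embℕ-affine-irrational : ∀ C D x → 1 ≤ C → Irrational x → Irrational (embℕ C ⊗ᵇ x ⊕ᵇ embℕ D)
  embℕ-affine-irrational C D (u , v) 1≤C irr =
    subst Irrational (sym (embℕ-affine C D u v)) (p*q≢0 (ℕ→ℚ-≢0 1≤C) irr)

  möbius⇔explicit : ∀ A B C D x u v → Möbius (mat A B C D) x (u , v) ⇔
                    x ⊗ᵇ (ℕ→ℚ C * u + ℕ→ℚ D , ℕ→ℚ C * v) ≡ (ℕ→ℚ A * u + ℕ→ℚ B , ℕ→ℚ A * v)
  möbius⇔explicit A B C D x u v = mk⇔ (subst₂ (λ l r → x ⊗ᵇ l ≡ r) (embℕ-affine C D u v) (embℕ-affine A B u v))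
                                      (subst₂ (λ l r → x ⊗ᵇ l ≡ r) (sym (embℕ-affine C D u v)) (sym (embℕ-affine A B u v)))

  -- Completing the square: (2Cu + D - A)² = Δ + 4C (Cu² + (D - A) u - B).
  rational-fixedPoint⇒discriminant-square : ∀ M u → Möbius M (u , 0ℚ) (u , 0ℚ) → IsSquareℚ (discriminant M)
  rational-fixedPoint⇒discriminant-square (mat A B C D) u fixed = r , (begin
    r * r                                    ≡⟨ expand b u A′ B′ C′ D′ ⟩
    Δ + ℕ→ℚ 4 * C′ * (lhs - rhs)             ≡⟨ cong (λ e → Δ + ℕ→ℚ 4 * C′ * e) (p≡q⇒p-q≡0 (cong proj₁ fixed′)) ⟩
    Δ + ℕ→ℚ 4 * C′ * 0ℚ                      ≡⟨ drop-zero Δ (ℕ→ℚ 4 * C′) ⟩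
    Δ                                        ∎)
    where
    open ≡-Reasoning
    A′ = ℕ→ℚ A ; B′ = ℕ→ℚ B ; C′ = ℕ→ℚ C ; D′ = ℕ→ℚ D
    r = C′ * (ℕ→ℚ 2 * u) + D′ - A′
    Δ = discriminant (mat A B C D)
    lhs = u * (C′ * u + D′) + b * (0ℚ * (C′ * 0ℚ))
    rhs = A′ * u + B′
    fixed′ = Equivalence.to (möbius⇔explicit A B C D (u , 0ℚ) u 0ℚ) fixed
    expand : ∀ b u A B C D → let r = C * (ℕ→ℚ 2 * u) + D - A in
             r * r ≡ (D - A) * (D - A) + ℕ→ℚ 4 * (B * C) + ℕ→ℚ 4 * C * ((u * (C * u + D) + b * (0ℚ * (C * 0ℚ))) - (A * u + B))
    expand = solve-∀ ℚ-ring
    drop-zero : ∀ p q → p + q * 0ℚ ≡ p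
    drop-zero = solve-∀ ℚ-ring

  -- The √b-part of the fixed-point equation reads v (2Cu + D - A) = 0, and v = 0 would make Δ a square.
  fixedPoint-rationalPart : ∀ M u v → ¬ IsSquareℚ (discriminant M) → Möbius M (u , v) (u , v) →
                            ℕ→ℚ (m₂₁ M) * (ℕ→ℚ 2 * u) + ℕ→ℚ (m₂₂ M) ≡ ℕ→ℚ (m₁₁ M)
  fixedPoint-rationalPart M@(mat A B C D) u v Δ-nonsquare fixed =
    p-q≡0⇒p≡q _ _ (decidable-stable (r ℚ.≟ 0ℚ) r≢0-impossible)
    where
    A′ = ℕ→ℚ A ; C′ = ℕ→ℚ C ; D′ = ℕ→ℚ D
    r = C′ * (ℕ→ℚ 2 * u) + D′ - A′
    fixed′ = Equivalence.to (möbius⇔explicit A B C D (u , v) u v) fixed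
    factor : ∀ u v A C D → (C * (ℕ→ℚ 2 * u) + D - A) * v ≡ (u * (C * v) + v * (C * u + D)) - A * v
    factor = solve-∀ ℚ-ring
    r≢0-impossible : ¬ r ≢ 0ℚ
    r≢0-impossible r≢0 = Δ-nonsquare (rational-fixedPoint⇒discriminant-square M u
                           (subst (λ v → Möbius M (u , v) (u , v)) v≡0 fixed))
      where
      v≡0 : v ≡ 0ℚ
      v≡0 = p*q≡0⇒q≡0 r≢0 (trans (factor u v A′ C′ D′) (p≡q⇒p-q≡0 (cong proj₂ fixed′)))

module Reciprocals (b : ℚ) (b-nonsquare : ¬ IsSquareℚ b) where
  open QuadraticField b

  norm : Qsqrt → ℚ
  norm (u , v) = u * u - b * (v * v)

  norm≢0 : ∀ x → Irrational x → norm x ≢ 0ℚ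
  norm≢0 (u , v) v≢0 N≡0 = b-nonsquare (u * 1/v , (begin
    (u * 1/v) * (u * 1/v)         ≡⟨ regroup u 1/v ⟩
    (u * u) * (1/v * 1/v)         ≡⟨ cong (_* (1/v * 1/v)) (p-q≡0⇒p≡q (u * u) (b * (v * v)) N≡0) ⟩
    (b * (v * v)) * (1/v * 1/v)   ≡⟨ regroup′ b v 1/v ⟩
    b * ((v * 1/v) * (v * 1/v))   ≡⟨ cong (λ e → b * (e * e)) (ℚ.*-inverseʳ v) ⟩
    b * (1ℚ * 1ℚ)                 ≡⟨ ℚ.*-identityʳ b ⟩
    b                             ∎))
    where
    open ≡-Reasoning
    instance _ = ℚ.≢-nonZero v≢0
    1/v = 1/ v
    regroup : ∀ p q → (p * q) * (p * q) ≡ (p * p) * (q * q)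
    regroup = solve-∀ ℚ-ring
    regroup′ : ∀ b p q → (b * (p * p)) * (q * q) ≡ b * ((p * q) * (p * q))
    regroup′ = solve-∀ ℚ-ring

  private
    1/norm : (x : Qsqrt) → Irrational x → ℚ
    1/norm x irr = (1/ norm x) {{ℚ.≢-nonZero (norm≢0 x irr)}}

  inverse : (x : Qsqrt) → Irrational x → Qsqrt
  inverse (u , v) irr = (u * 1/norm (u , v) irr , - v * 1/norm (u , v) irr)

  ⊗-inverseˡ : ∀ x irr → inverse x irr ⊗ᵇ x ≡ oneQ
  ⊗-inverseˡ (u , v) irr = cong₂ _,_
    (trans (rational b u v n) (ℚ.*-inverseʳ (norm (u , v)) {{ℚ.≢-nonZero (norm≢0 (u , v) irr)}}))
    (irrational u v n)
    where
    n = 1/norm (u , v) irr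
    rational : ∀ b u v n → u * n * u + b * (- v * n * v) ≡ (u * u - b * (v * v)) * n
    rational = solve-∀ ℚ-ring
    irrational : ∀ u v n → u * n * v + - v * n * u ≡ 0ℚ
    irrational = solve-∀ ℚ-ring

  inverse-irrational : ∀ x irr → Irrational (inverse x irr)
  inverse-irrational (u , v) irr =
    p*q≢0 (irr ∘ ℚ.neg-injective) (1/p≢0 (norm (u , v)) {{ℚ.≢-nonZero (norm≢0 (u , v) irr)}})

  ⊗-cancelʳ : ∀ {w} y y′ → Irrational w → y ⊗ᵇ w ≡ y′ ⊗ᵇ w → y ≡ y′
  ⊗-cancelʳ {w} y y′ irr yw≡y′w = begin
    y                           ≡⟨ sym (⊗-identityʳ y) ⟩
    y ⊗ᵇ oneQ                   ≡⟨ cong (y ⊗ᵇ_) ww⁻¹≡1 ⟨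
    y ⊗ᵇ (w ⊗ᵇ w⁻¹)             ≡⟨ ⊗-assoc y w w⁻¹ ⟨
    y ⊗ᵇ w ⊗ᵇ w⁻¹               ≡⟨ cong (_⊗ᵇ w⁻¹) yw≡y′w ⟩
    y′ ⊗ᵇ w ⊗ᵇ w⁻¹              ≡⟨ ⊗-assoc y′ w w⁻¹ ⟩
    y′ ⊗ᵇ (w ⊗ᵇ w⁻¹)            ≡⟨ cong (y′ ⊗ᵇ_) ww⁻¹≡1 ⟩
    y′ ⊗ᵇ oneQ                  ≡⟨ ⊗-identityʳ y′ ⟩
    y′                          ∎
    where
    open ≡-Reasoning
    w⁻¹ = inverse w irr
    ww⁻¹≡1 : w ⊗ᵇ w⁻¹ ≡ oneQ
    ww⁻¹≡1 = trans (⊗-comm w w⁻¹) (⊗-inverseˡ w irr)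

  embℕ-⊕-irrational : ∀ k x → Irrational x → Irrational (embℕ k ⊕ᵇ x)
  embℕ-⊕-irrational k (u , v) irr = irr ∘ trans (sym (ℚ.+-identityˡ v))

  reciprocal : ℕ → Σ Qsqrt Irrational → Σ Qsqrt Irrational
  reciprocal k (y , irr) = inverse (embℕ k ⊕ᵇ y) irr′ , inverse-irrational (embℕ k ⊕ᵇ y) irr′
    where
    irr′ : Irrational (embℕ k ⊕ᵇ y)
    irr′ = embℕ-⊕-irrational k y irr

  tails : ∀ n → (Fin n → ℕ) → Σ Qsqrt Irrational → Fin (suc n) → Σ Qsqrt Irrational
  tails zero    c y zero    = y
  tails (suc n) c y zero    = reciprocal (c zero) (tails n (c ∘ suc) y zero)
  tails (suc n) c y (suc i) = tails n (c ∘ suc) y i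

  tails-step : ∀ n c y (i : Fin n) →
               proj₁ (tails n c y (inject₁ i)) ⊗ᵇ (embℕ (c i) ⊕ᵇ proj₁ (tails n c y (suc i))) ≡ oneQ
  tails-step (suc n) c y zero    = ⊗-inverseˡ (embℕ (c zero) ⊕ᵇ proj₁ t) (embℕ-⊕-irrational (c zero) (proj₁ t) (proj₂ t))
    where
    t = tails n (c ∘ suc) y zero
  tails-step (suc n) c y (suc i) = tails-step n (c ∘ suc) y i

  tails-last : ∀ n c y → tails n c y (fromℕ n) ≡ y
  tails-last zero    c y = refl
  tails-last (suc n) c y = tails-last n (c ∘ suc) y

-- Existence of a purely periodic expansion

private
  defect-vanishes : ∀ {p q e} k → p ≡ q + (e - 1ℚ) * k → e ≡ 1ℚ → p ≡ q
  defect-vanishes {q = q} k p≡q+[e-1]k refl = trans p≡q+[e-1]k (cancel q k)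
    where
    cancel : ∀ q k → q + (1ℚ - 1ℚ) * k ≡ q
    cancel = solve-∀ ℚ-ring

-- For 2Ch = 1 this is (A - D + √Δ) / 2C, a root of C x² + (D - A) x - B.
fixedPoint : Mat₂ → ℚ → Qsqrt
fixedPoint M h = ((ℕ→ℚ (m₁₁ M) - ℕ→ℚ (m₂₂ M)) * h , h)

fixedPoint-möbius : ∀ M h → ℕ→ℚ 2 * ℕ→ℚ (m₂₁ M) * h ≡ 1ℚ →
                    QuadraticField.Möbius (discriminant M) M (fixedPoint M h) (fixedPoint M h)
fixedPoint-möbius M@(mat A B C D) h 2Ch≡1 = Equivalence.from (möbius⇔explicit A B C D (fixedPoint M h) u h)
  (cong₂ _,_ (defect-vanishes _ (rational A′ B′ C′ D′ h) 2Ch≡1) (defect-vanishes _ (irrational A′ C′ D′ h) 2Ch≡1))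
  where
  open QuadraticField (discriminant M)
  A′ = ℕ→ℚ A ; B′ = ℕ→ℚ B ; C′ = ℕ→ℚ C ; D′ = ℕ→ℚ D
  u = (A′ - D′) * h
  rational : ∀ A B C D h → let u = (A - D) * h ; Δ = (D - A) * (D - A) + ℕ→ℚ 4 * (B * C) in
    u * (C * u + D) + Δ * (h * (C * h))
      ≡ A * u + B + (ℕ→ℚ 2 * C * h - 1ℚ) * ((A - D) * (A - D) * h + B * (ℕ→ℚ 2 * C * h + 1ℚ))
  rational = solve-∀ ℚ-ring
  irrational : ∀ A C D h → let u = (A - D) * h in
    u * (C * h) + h * (C * u + D) ≡ A * h + (ℕ→ℚ 2 * C * h - 1ℚ) * ((A - D) * h)
  irrational = solve-∀ ℚ-ring

periodicCF-exists : ∀ m (c : Fin (suc m) → ℕ) → (∀ i → 1 ≤ c i) →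
                    Σ ℚ λ b → Σ (Fin (suc (suc m)) → Qsqrt) λ t → PeriodicCF m c b t
periodicCF-exists m c pos = Δ , t , Δ-nonsquare , tails-step (suc m) c x₀ , periodic
  where
  M = cfMatrix (suc m) c
  Δ = discriminant M
  Δ-nonsquare = hyperbolic⇒discriminant-nonsquare M (cfMatrix-hyperbolic m c pos)
  open QuadraticField Δ
  open Reciprocals Δ Δ-nonsquare
  1≤C : 1 ≤ m₂₁ M
  1≤C = Ordered.1≤c (cfMatrix-ordered m c pos)
  instance
    2C≢0 : ℚ.NonZero (ℕ→ℚ 2 * ℕ→ℚ (m₂₁ M))
    2C≢0 = ℚ.≢-nonZero (p*q≢0 (ℕ→ℚ-≢0 {2} (s≤s z≤n)) (ℕ→ℚ-≢0 1≤C))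
  h = 1/ (ℕ→ℚ 2 * ℕ→ℚ (m₂₁ M))
  x₀ : Σ Qsqrt Irrational
  x₀ = fixedPoint M h , 1/p≢0 (ℕ→ℚ 2 * ℕ→ℚ (m₂₁ M))
  t = proj₁ ∘ tails (suc m) c x₀
  t-last : t (fromℕ (suc m)) ≡ proj₁ x₀
  t-last = cong proj₁ (tails-last (suc m) c x₀)
  t₀-möbius : Möbius M (t zero) (proj₁ x₀)
  t₀-möbius = subst (Möbius M (t zero)) t-last (cfMatrix-möbius (suc m) c t (tails-step (suc m) c x₀))
  x₀-möbius : Möbius M (proj₁ x₀) (proj₁ x₀)
  x₀-möbius = fixedPoint-möbius M h (ℚ.*-inverseʳ (ℕ→ℚ 2 * ℕ→ℚ (m₂₁ M)))
  -- t 0 and x₀ both satisfy y (C x₀ + D) = A x₀ + B, and C x₀ + D is invertible.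
  periodic : t (fromℕ (suc m)) ≡ t zero
  periodic = trans t-last (sym (⊗-cancelʳ (t zero) (proj₁ x₀) Cx₀+D-irrational (trans t₀-möbius (sym x₀-möbius))))
    where
    Cx₀+D-irrational = embℕ-affine-irrational (m₂₁ M) (m₂₂ M) (proj₁ x₀) 1≤C (proj₂ x₀)

-- The rational part of a purely periodic expansion

s*z+r≡q⇒z≡0 : ∀ {q r s} → q < s ℕ.+ r → r < s ℕ.+ q → ∀ z → + s ℤ.* z ℤ.+ + r ≡ + q → z ≡ + 0
s*z+r≡q⇒z≡0 _ _ (+ zero) _ = refl
s*z+r≡q⇒z≡0 {q} {r} {s} q<s+r _ +[1+ n ] eq = ⊥-elim (ℕ.<⇒≱ q<s+r (begin
  s ℕ.+ r            ≤⟨ ℕ.+-monoˡ-≤ r (ℕ.m≤m*n s (suc n)) ⟩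
  s ℕ.* suc n ℕ.+ r  ≡⟨ ℤ.+-injective (trans (cong (ℤ._+ + r) (ℤ.pos-* s (suc n))) eq) ⟩
  q                  ∎))
  where open ℕ.≤-Reasoning
s*z+r≡q⇒z≡0 {q} {r} {s} _ r<s+q -[1+ n ] eq = ⊥-elim (ℕ.<⇒≱ r<s+q (begin
  s ℕ.+ q            ≤⟨ ℕ.+-monoˡ-≤ q (ℕ.m≤m*n s (suc n)) ⟩
  s ℕ.* suc n ℕ.+ q  ≡⟨ ℕ.+-comm (s ℕ.* suc n) q ⟩
  q ℕ.+ s ℕ.* suc n  ≡⟨ ℤ.+-injective r≡q+s[1+n] ⟨
  r                  ∎))
  where
  open ℕ.≤-Reasoning
  P = + (s ℕ.* suc n)
  -P+r≡q : ℤ.- P ℤ.+ + r ≡ + q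
  -P+r≡q = trans (cong (ℤ._+ + r) (trans (cong ℤ.-_ (ℤ.pos-* s (suc n))) (ℤ.neg-distribʳ-* (+ s) (+ suc n)))) eq
  move : ∀ p r → r ≡ (ℤ.- p ℤ.+ r) ℤ.+ p
  move = ℤ-Solver.solve-∀
  r≡q+s[1+n] : + r ≡ + q ℤ.+ P
  r≡q+s[1+n] = trans (move P (+ r)) (cong (ℤ._+ P) -P+r≡q)

rationalPart-conditions : ∀ {q r s x} w → q < s ℕ.+ r → r < s ℕ.+ q →
                          ℕ→ℚ s * (w + ℕ→ℚ x) + ℕ→ℚ r ≡ ℕ→ℚ q →
                          ((∃ λ (z : ℤ) → w ≡ ℤ→ℚ z) ⇔ (w ≡ - ℕ→ℚ x)) × ((w ≡ - ℕ→ℚ x) ⇔ (q ≡ r))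
rationalPart-conditions {q} {r} {s} {x} w q<s+r r<s+q eq =
  mk⇔ integral⇒ ⇒integral , mk⇔ ⇒q≡r q≡r⇒
  where
  open ≡-Reasoning
  X = ℕ→ℚ x
  integral⇒ : (∃ λ (z : ℤ) → w ≡ ℤ→ℚ z) → w ≡ - X
  integral⇒ (z , w≡z) = p+q≡0⇒p≡-q w X (begin
    w + X               ≡⟨ cong (_+ X) w≡z ⟩
    ℤ→ℚ z + X           ≡⟨ ℤ→ℚ-homo-+ z (+ x) ⟨
    ℤ→ℚ (z ℤ.+ + x)     ≡⟨ cong ℤ→ℚ (s*z+r≡q⇒z≡0 q<s+r r<s+q (z ℤ.+ + x) (ℤ→ℚ-injective eqℚ)) ⟩
    0ℚ                  ∎)
    where
    eqℚ : ℤ→ℚ (+ s ℤ.* (z ℤ.+ + x) ℤ.+ + r) ≡ ℤ→ℚ (+ q)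
    eqℚ = begin
      ℤ→ℚ (+ s ℤ.* (z ℤ.+ + x) ℤ.+ + r)   ≡⟨ ℤ→ℚ-homo-+ (+ s ℤ.* (z ℤ.+ + x)) (+ r) ⟩
      ℤ→ℚ (+ s ℤ.* (z ℤ.+ + x)) + ℕ→ℚ r   ≡⟨ cong (_+ ℕ→ℚ r) (ℤ→ℚ-homo-* (+ s) (z ℤ.+ + x)) ⟩
      ℕ→ℚ s * ℤ→ℚ (z ℤ.+ + x) + ℕ→ℚ r     ≡⟨ cong (λ e → ℕ→ℚ s * e + ℕ→ℚ r) (ℤ→ℚ-homo-+ z (+ x)) ⟩
      ℕ→ℚ s * (ℤ→ℚ z + X) + ℕ→ℚ r         ≡⟨ cong (λ e → ℕ→ℚ s * (e + X) + ℕ→ℚ r) w≡z ⟨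
      ℕ→ℚ s * (w + X) + ℕ→ℚ r             ≡⟨ eq ⟩
      ℕ→ℚ q                               ∎
  ⇒integral : w ≡ - X → ∃ λ (z : ℤ) → w ≡ ℤ→ℚ z
  ⇒integral w≡-X = ℤ.- + x , trans w≡-X (sym (ℤ→ℚ-neg-ℕ x))
  ⇒q≡r : w ≡ - X → q ≡ r
  ⇒q≡r w≡-X = sym (ℕ→ℚ-injective (begin
    ℕ→ℚ r                      ≡⟨ drop-zero (ℕ→ℚ s) (ℕ→ℚ r) ⟩
    ℕ→ℚ s * 0ℚ + ℕ→ℚ r         ≡⟨ cong (λ e → ℕ→ℚ s * e + ℕ→ℚ r) (trans (cong (_+ X) w≡-X) (ℚ.+-inverseˡ X)) ⟨
    ℕ→ℚ s * (w + X) + ℕ→ℚ r    ≡⟨ eq ⟩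
    ℕ→ℚ q                      ∎))
    where
    drop-zero : ∀ p q → q ≡ p * 0ℚ + q
    drop-zero = solve-∀ ℚ-ring
  q≡r⇒ : q ≡ r → w ≡ - X
  q≡r⇒ q≡r = p+q≡0⇒p≡-q w X (p*q≡0⇒q≡0 (ℕ→ℚ-≢0 1≤s) (p+q≡q⇒p≡0 _ _ (trans eq (cong ℕ→ℚ q≡r))))
    where
    1≤s : 1 ≤ s
    1≤s = ℕ.+-cancelʳ-< q 0 s (subst (_< s ℕ.+ q) (sym q≡r) r<s+q)

periodicCF-rationalPart : ∀ m (c : Fin (suc m) → ℕ) → (∀ i → 1 ≤ c i) → ∀ b t → PeriodicCF m c b t →
  let M₀ = cfMatrix m (c ∘ inject₁) in
  ℕ→ℚ (m₂₂ M₀) * (ℕ→ℚ 2 * ratPart (t zero) + ℕ→ℚ (c (fromℕ m))) + ℕ→ℚ (m₂₁ M₀) ≡ ℕ→ℚ (m₁₂ M₀)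
periodicCF-rationalPart m c pos b t (_ , steps , periodic) = begin
  S * (w + X) + R              ≡⟨ regroup S w X R ⟩
  S * w + (R + S * X)          ≡⟨ cong (λ e → S * w + e) (trans (ℕ→ℚ-homo-+ r (s ℕ.* x)) (cong (_+_ R) (ℕ→ℚ-homo-* s x))) ⟨
  S * w + ℕ→ℚ (r ℕ.+ s ℕ.* x)  ≡⟨ subst (λ N → ℕ→ℚ (m₂₁ N) * w + ℕ→ℚ (m₂₂ N) ≡ ℕ→ℚ (m₁₁ N)) (cfMatrix-snoc m c) 2Cu+D≡A ⟩
  ℕ→ℚ q                        ∎
  where
  open ≡-Reasoning
  open QuadraticField b
  M = cfMatrix (suc m) c
  q = m₁₂ (cfMatrix m (c ∘ inject₁)) ; r = m₂₁ (cfMatrix m (c ∘ inject₁)) ; s = m₂₂ (cfMatrix m (c ∘ inject₁))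
  x = c (fromℕ m)
  S = ℕ→ℚ s ; R = ℕ→ℚ r ; X = ℕ→ℚ x
  w = ℕ→ℚ 2 * ratPart (t zero)
  t₀-fixed : Möbius M (t zero) (t zero)
  t₀-fixed = subst (Möbius M (t zero)) periodic (cfMatrix-möbius (suc m) c t steps)
  2Cu+D≡A : ℕ→ℚ (m₂₁ M) * w + ℕ→ℚ (m₂₂ M) ≡ ℕ→ℚ (m₁₁ M)
  2Cu+D≡A = fixedPoint-rationalPart M (proj₁ (t zero)) (proj₂ (t zero))
              (hyperbolic⇒discriminant-nonsquare M (cfMatrix-hyperbolic m c pos)) t₀-fixed
  regroup : ∀ S w X R → S * (w + X) + R ≡ S * w + (R + S * X)
  regroup = solve-∀ ℚ-ring

theorem2 : (m : ℕ) (c : Fin (suc m) → ℕ) → ((i : Fin (suc m)) → 1 ≤ c i)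
    → (Σ ℚ λ b → Σ (Fin (suc (suc m)) → Qsqrt) λ t → PeriodicCF m c b t)
      × ((b : ℚ) (t : Fin (suc (suc m)) → Qsqrt) → PeriodicCF m c b t
        → ((∃ λ (z : ℤ) → ℕ→ℚ 2 * ratPart (t zero) ≡ ℤ→ℚ z)
            ⇔ (ℕ→ℚ 2 * ratPart (t zero) ≡ - ℕ→ℚ (c (fromℕ m))))
          × ((ℕ→ℚ 2 * ratPart (t zero) ≡ - ℕ→ℚ (c (fromℕ m)))
            ⇔ ((j : Fin m) → c (inject₁ j) ≡ c (inject₁ (opposite j)))))
theorem2 m c pos = periodicCF-exists m c pos , λ b t cf →
  let a⇔b , b⇔q≡r =
        rationalPart-conditions {x = c (fromℕ m)} (ℕ→ℚ 2 * ratPart (t zero)) q<s+r r<s+q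
                                (periodicCF-rationalPart m c pos b t cf)
  in a⇔b , symmetric⇔palindrome m (c ∘ inject₁) (pos ∘ inject₁) ⇔-∘ b⇔q≡r
  where
  q<s+r = proj₁ (cfMatrix-offDiagonal-bound m (c ∘ inject₁) (pos ∘ inject₁))
  r<s+q = proj₂ (cfMatrix-offDiagonal-bound m (c ∘ inject₁) (pos ∘ inject₁))
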